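{- Let $m,n\ge 1$. For every rectangular EW-tableau $T\in \mathsf{EW}_{m,n}$, the output $\phi(T)=(R,\ell)$ of the construction $\phi$ described in the context is a labelled ribbon parallelogram polyomino, i.e. $\phi(T)\in\mathsf{LRib}_{m,n}$. Thus $\phi$ is a map $\mathsf{EW}_{m,n}\to\mathsf{LRib}_{m,n}$.
   Context: All tableaux are $0/1$ arrays; $T_{ij}$ denotes the entry in row $i$ (rows numbered top to bottom) and column $j$ (columns numbered left to right). Labels are symbols $v_0,v_1,\dots,v_{m+n-1}$, ordered by $v_i<v_j$ iff $i<j$. Rectangular EW-tableau: an $m\times n$ $0/1$ tableau $T$ such that (i) every entry of the top row is $1$; (ii) every other row contains at least one $0$; (iii) there are no rows $i\ne i'$ and columns $k\ne k'$ with $T_{ik}=T_{i'k'}=0$ and $T_{ik'}=T_{i'k}=1$. $\mathsf{EW}_{m,n}$ is the set of these. The rows of $T$ are labelled $v_0,\dots,v_{m-1}$ from top to bottom and the columns $v_m,\dots,v_{m+n-1}$ from left to right. Parallelogram polyomino of type $(m,n)$: an $m\times n$ $0/1$ tableau $P$ with $P_{11}=P_{mn}=1$, such that every row contains at least one $1$ and the $1$s in each row are contiguous, and for each $2\le i\le m$: the leftmost $1$ of row $i$ is weakly to the right of the leftmost $1$ of row $i-1$ and weakly to the left of the rightmost $1$ of row $i-1$, and the rightmost $1$ of row $i$ is weakly to the right of the rightmost $1$ of row $i-1$. It is a ribbon parallelogram polyomino if it has exactly $m+n-1$ entries equal to $1$ (the minimal possible number). Labelled parallelogram polyomino of type $(m,n)$: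 a pair $(P,\ell)$ with $P$ a parallelogram polyomino of type $(m,n)$ and $\ell=(\ell(\mathrm{row}_1),\dots,\ell(\mathrm{row}_m),\ell(\mathrm{col}_1),\dots,\ell(\mathrm{col}_n))$, where the row labels are a permutation of $\{v_0,\dots,v_{m-1}\}$ with $\ell(\mathrm{row}_1)=v_0$ and such that the labels of rows whose leftmost $1$s lie in the same column are increasing from top to bottom, and the column labels are a permutation of $\{v_m,\dots,v_{m+n-1}\}$ such that the labels of columns whose topmost $1$s lie in the same row are increasing from left to right. $\mathsf{LRib}_{m,n}$ is the set of those with $P$ a ribbon parallelogram polyomino. The construction $\phi$: given $T\in\mathsf{EW}_{m,n}$ with its labels, (1) permute the columns (carrying their labels) so that every entry to the left of a $0$ is a $0$, with identical columns placed so their labels increase from left to right; (2) then permute the rows (carrying labels) so that every entry above a $1$ is a $1$, with identical rows placed so their labels increase from top to bottom; call the result $T'$ and the resulting labelling $\ell$. (3) Let $R$ be the $m\times n$ tableau with $R_{ij}=1$ if either [$T'_{ij}=1$ and ($i=m$ or $T'_{i+1,j}=0$)] or [$T'_{ij}=0$ and ($j=n$ or $T'_{i,j+1}=1$)], and $R_{ij}=0$ otherwise. Set $\phi(T)=(R,\ell)$. -}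

module Defs where

open import Data.Nat as ℕ using (ℕ; zero; suc; _+_; _∸_)
open import Data.Fin as F using (Fin; toℕ; _<_; _≤_)
open import Data.Bool using (Bool; true; false; not; _∧_; _∨_; T?)
open import Data.Maybe using (Maybe; just; nothing; maybe)
import Data.Maybe as Maybe
open import Data.List using (List; length; filter; map; allFin)
open import Data.Nat.ListAction using (sum)
open import Data.Product using (Σ; ∃; ∃-syntax; _×_; _,_)
open import Relation.Binary.PropositionalEquality using (_≡_; _≢_)
open import Relation.Nullary using (¬_)
open import Function.Definitions using (Bijective)

-- A 0/1 tableau with m rows and n columns; entry T i j is the entry in
-- row i (0-based, top to bottom) and column j (0-based, left to right);
-- true = 1, false = 0.
Tableau : ℕ → ℕ → Set
Tableau m n = Fin m → Fin n → Bool

record IsEW {m n : ℕ} (T : Tableau m n) : Set where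
  field
    topRowOnes : ∀ i j → toℕ i ≡ 0 → T i j ≡ true
    otherRowsZero : ∀ i → toℕ i ≢ 0 → ∃[ j ] T i j ≡ false
    noPattern : ¬ (Σ (Fin m) λ i → Σ (Fin m) λ i' → Σ (Fin n) λ k → Σ (Fin n) λ k' →
                    i ≢ i' × k ≢ k' × T i k ≡ false × T i' k' ≡ false
                    × T i k' ≡ true × T i' k ≡ true)

-- Row r is labelled v_{toℕ (rowLab r)}, column c is labelled
-- v_{m + toℕ (colLab c)}; thus v-order on row labels (resp. column
-- labels) is the order of rowLab (resp. colLab) values in Fin.

record Labelling (m n : ℕ) : Set where
  constructor mkLab
  field
    rowLab : Fin m → Fin m
    colLab : Fin n → Fin n

IsLeftmost : {m n : ℕ} → Tableau m n → Fin m → Fin n → Set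
IsLeftmost P i j = P i j ≡ true × (∀ j' → j' < j → P i j' ≡ false)

IsRightmost : {m n : ℕ} → Tableau m n → Fin m → Fin n → Set
IsRightmost P i j = P i j ≡ true × (∀ j' → j < j' → P i j' ≡ false)

IsTopmost : {m n : ℕ} → Tableau m n → Fin n → Fin m → Set
IsTopmost P j i = P i j ≡ true × (∀ i' → i' < i → P i' j ≡ false)

record IsParallelogramPolyomino {m n : ℕ} (P : Tableau m n) : Set where
  field
    firstCorner : ∀ i j → toℕ i ≡ 0 → toℕ j ≡ 0 → P i j ≡ true
    lastCorner : ∀ i j → suc (toℕ i) ≡ m → suc (toℕ j) ≡ n → P i j ≡ true
    rowNonempty : ∀ i → ∃[ j ] P i j ≡ true
    rowContiguous : ∀ i j k l → j ≤ k → k ≤ l → P i j ≡ true → P i l ≡ true → P i k ≡ true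
    consecutive : ∀ i i' → toℕ i' ≡ suc (toℕ i) → ∀ a b a' b' →
                  IsLeftmost P i a → IsRightmost P i b →
                  IsLeftmost P i' a' → IsRightmost P i' b' →
                  (a ≤ a' × a' ≤ b) × b ≤ b'

countTrue : {n : ℕ} → (Fin n → Bool) → ℕ
countTrue {n} f = length (filter (λ j → T? (f j)) (allFin n))

numOnes : {m n : ℕ} → Tableau m n → ℕ
numOnes {m} P = sum (map (λ i → countTrue (P i)) (allFin m))

record IsRibbonPolyomino {m n : ℕ} (P : Tableau m n) : Set where
  field
    isPP : IsParallelogramPolyomino P
    minimal : numOnes P ≡ m + n ∸ 1

record IsLRib {m n : ℕ} (P : Tableau m n) (ℓ : Labelling m n) : Set where
  open Labelling ℓ
  field
    ribbon : IsRibbonPolyomino P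
    rowPerm : Bijective _≡_ _≡_ rowLab
    colPerm : Bijective _≡_ _≡_ colLab
    firstRowLabel : ∀ i → toℕ i ≡ 0 → toℕ (rowLab i) ≡ 0
    rowLabelsIncr : ∀ i i' a → i < i' → IsLeftmost P i a → IsLeftmost P i' a →
                    rowLab i < rowLab i'
    colLabelsIncr : ∀ j j' a → j < j' → IsTopmost P j a → IsTopmost P j' a →
                    colLab j < colLab j'

-- The construction φ.
-- σ j = original column placed at position j; τ i = original row placed
-- at position i.

colPermuted : {m n : ℕ} → Tableau m n → (Fin n → Fin n) → Tableau m n
colPermuted T σ i j = T i (σ j)

permuted : {m n : ℕ} → Tableau m n → (Fin n → Fin n) → (Fin m → Fin m) → Tableau m n
permuted T σ τ i j = T (τ i) (σ j)

record IsColumnStep {m n : ℕ} (T : Tableau m n) (σ : Fin n → Fin n) : Set where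
  field
    colBij : Bijective _≡_ _≡_ σ
    zerosLeft : ∀ i j j' → j' < j → T i (σ j) ≡ false → T i (σ j') ≡ false
    colTies : ∀ j j' → j' < j → (∀ i → T i (σ j) ≡ T i (σ j')) → σ j' < σ j

record IsRowStep {m n : ℕ} (T1 : Tableau m n) (τ : Fin m → Fin m) : Set where
  field
    rowBij : Bijective _≡_ _≡_ τ
    onesAbove : ∀ i i' j → i' < i → T1 (τ i) j ≡ true → T1 (τ i') j ≡ true
    rowTies : ∀ i i' → i' < i → (∀ j → T1 (τ i) j ≡ T1 (τ i') j) → τ i' < τ i

IsPhiPerm : {m n : ℕ} → Tableau m n → (Fin n → Fin n) → (Fin m → Fin m) → Set
IsPhiPerm T σ τ = IsColumnStep T σ × IsRowStep (colPermuted T σ) τ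

nextFin : {n : ℕ} → Fin n → Maybe (Fin n)
nextFin {suc zero} F.zero = nothing
nextFin {suc (suc n)} F.zero = just (F.suc F.zero)
nextFin {suc (suc n)} (F.suc i) = Maybe.map F.suc (nextFin i)

ribbonOf : {m n : ℕ} → Tableau m n → Tableau m n
ribbonOf T' i j =
  (T' i j ∧ maybe (λ i₁ → not (T' i₁ j)) true (nextFin i))
  ∨ (not (T' i j) ∧ maybe (λ j₁ → T' i j₁) true (nextFin j))

phiShape : {m n : ℕ} → Tableau m n → (Fin n → Fin n) → (Fin m → Fin m) → Tableau m n
phiShape T σ τ = ribbonOf (permuted T σ τ)

phiLabel : {m n : ℕ} → (Fin n → Fin n) → (Fin m → Fin m) → Labelling m n
phiLabel σ τ = mkLab τ σ

-- Sorting the columns of T by their sets of zeros and then the rows by their sets of ones is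
-- possible because both families of sets are chains under inclusion (for the columns this is
-- exactly the forbidden 2×2 pattern); a sort that breaks ties by index is obtained by ranking
-- every element in the order "larger set first, then smaller index".  The sorted tableau S is a
-- staircase: row i of S is 0 before column s i and 1 from there on, where
-- 0 = s 0 ≤ s 1 ≤ ⋯ ≤ s m = n and s i ≥ 1 for i ≥ 1, because the top row of an EW-tableau is full
-- and every other row contains a 0.  Step (3) keeps in row i exactly the columns
-- pred (s i) ≤ j < s (i + 1).  These intervals form a parallelogram polyomino whose row lengths
-- s (i + 1) − s i + 1 (one less for the top row) telescope to m + n − 1.  Equal leftmost cells of
-- two rows i, i' ≥ 1 force s i = s i', and equal topmost cells of two columns force them to lie
-- in the same gap of s; either way the corresponding lines of S coincide, so the tie-breaking of
-- the sorts makes the labels increase.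

module Submission where

open import Defs
open import Data.Bool using (Bool; true; false; not; if_then_else_; T?)
open import Data.Bool.Properties using (not-injective; not-¬; ¬-not)
open import Data.Fin as Fin using (Fin; zero; suc; toℕ; fromℕ<; inject₁; punchOut)
open import Data.Fin.Properties as Finₚ
  using (toℕ<n; toℕ-fromℕ<; fromℕ<-toℕ; toℕ-injective; toℕ-inject₁; punchOut-injective; injective⇒≤; any?)
open import Data.List using (length; filter; map; tabulate; allFin)
open import Data.List.Properties using (map-tabulate; tabulate-cong)
open import Data.Maybe using (Maybe; just; nothing; maybe)
open import Data.Nat using (ℕ; zero; suc; pred; _+_; _∸_; _≤_; _<_; z≤n; s≤s; z<s; s<s; s≤s⁻¹; _≤?_; _<?_; >-nonZero)
open import Data.Nat.ListAction using (sum)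
open import Data.Nat.Properties
  using ( ≤-refl; ≤-reflexive; ≤-trans; ≤-antisym; <-trans; ≤-<-trans; <-≤-trans; <⇒≤; <-irrefl; <-cmp
        ; <⇒≢; <⇒≱; ≮⇒≥; ≰⇒>; n≤1+n; m≤n⇒m≤1+n; m≤n⇒m<n∨m≡n; 1+n≰n; n≤0⇒n≡0; <-≤-connex; suc-pred
        ; pred[n]≤n; pred-mono-≤; pred-cancel-<; <⇒≤pred; 0∸n≡0; m∸n+n≡m
        ; +-mono-≤; +-mono-≤-<; +-comm; +-assoc; +-suc; +-identityʳ; suc-injective; module ≤-Reasoning)
open import Data.Product using (Σ; _×_; _,_; proj₁; proj₂)
open import Data.Sum using (_⊎_; inj₁; inj₂)
open import Function using (_∘_; id)
open import Function.Definitions using (Injective; Bijective; StrictlySurjective)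
open import Function.Consequences.Propositional
  using (strictlySurjective⇒surjective; surjective⇒strictlySurjective)
open import Relation.Binary.Definitions using (Transitive; tri<; tri≈; tri>)
open import Relation.Binary.PropositionalEquality
  using (_≡_; _≢_; refl; sym; trans; cong; subst; subst₂; _≗_; module ≡-Reasoning)
open import Relation.Nullary using (¬_; Dec; yes; no; does; proof; contradiction)
open import Relation.Nullary.Reflects using (Reflects; ofʸ; ofⁿ; det; ¬-reflects; _×-reflects_; _⊎-reflects_)

private
  variable
    A B : Set
    b : Bool
    m n N M : ℕ

infix 4 _⊆_
_⊆_ : (A → Bool) → (A → Bool) → Set
f ⊆ g = ∀ x → f x ≡ true → g x ≡ true

Reflects-map : (A → B) → (B → A) → Reflects A b → Reflects B b
Reflects-map f _ (ofʸ a)  = ofʸ (f a)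
Reflects-map _ g (ofⁿ ¬a) = ofⁿ (¬a ∘ g)

reflects-true⇒ : Reflects A b → b ≡ true → A
reflects-true⇒ (ofʸ a) _ = a
reflects-true⇒ (ofⁿ _) ()

reflects-false⇒ : Reflects A b → b ≡ false → ¬ A
reflects-false⇒ (ofⁿ ¬a) _ = ¬a
reflects-false⇒ (ofʸ _)  ()

reflects-⇒true : Reflects A b → A → b ≡ true
reflects-⇒true r a = det r (ofʸ a)

reflects-⇒false : Reflects A b → ¬ A → b ≡ false
reflects-⇒false r ¬a = det r (ofⁿ ¬a)

pred≤⇒≤suc : ∀ c {j} → pred c ≤ j → c ≤ suc j
pred≤⇒≤suc zero    _ = z≤n
pred≤⇒≤suc (suc c) p = s≤s p

pred<-of-≤ : ∀ {c h} → c ≤ h → 0 < h → pred c < h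
pred<-of-≤ {zero}  _   0<h = 0<h
pred<-of-≤ {suc c} c<h _   = c<h

bit : Bool → ℕ
bit b = if b then 1 else 0

count : (Fin n → Bool) → ℕ
count {zero}  f = 0
count {suc n} f = bit (f zero) + count (f ∘ suc)

countTrue≡count : (f : Fin n → Bool) → countTrue f ≡ count f
countTrue≡count {n} f = filtered id
  where
  filtered : ∀ {k} (g : Fin k → Fin n) → length (filter (λ j → T? (f j)) (tabulate g)) ≡ count (f ∘ g)
  filtered {zero}  g = refl
  filtered {suc k} g with f (g zero)
  ... | true  = cong suc (filtered (g ∘ suc))
  ... | false = filtered (g ∘ suc)

bit-mono : ∀ {a b} → (a ≡ true → b ≡ true) → bit a ≤ bit b
bit-mono {false} _   = z≤n
bit-mono {true}  a⇒b rewrite a⇒b refl = ≤-refl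

count-mono : {f g : Fin n → Bool} → f ⊆ g → count f ≤ count g
count-mono {zero}  _   = z≤n
count-mono {suc n} f⊆g = +-mono-≤ (bit-mono (f⊆g zero)) (count-mono (f⊆g ∘ suc))

count-strict : {f g : Fin n → Bool} → f ⊆ g → ∀ x → f x ≡ false → g x ≡ true → count f < count g
count-strict {suc n} f⊆g zero    fx gx rewrite fx | gx = s≤s (count-mono (f⊆g ∘ suc))
count-strict {suc n} f⊆g (suc x) fx gx =
  +-mono-≤-< (bit-mono (f⊆g zero)) (count-strict (f⊆g ∘ suc) x fx gx)

count-cong : {f g : Fin n → Bool} → f ≗ g → count f ≡ count g
count-cong f≗g = ≤-antisym (count-mono (λ x → trans (sym (f≗g x)))) (count-mono (λ x → trans (f≗g x)))

count-const-true : count {n} (λ _ → true) ≡ n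
count-const-true {zero}  = refl
count-const-true {suc n} = cong suc count-const-true

count-< : {f : Fin n → Bool} → ∀ x → f x ≡ false → count f < n
count-< {f = f} x fx = subst (count f <_) count-const-true (count-strict (λ _ _ → refl) x fx refl)

IsIndicator : (Fin n → Bool) → ℕ → ℕ → Set
IsIndicator f lo hi = ∀ j → Reflects (lo ≤ toℕ j × toℕ j < hi) (f j)

indicator-tail : {f : Fin (suc n) → Bool} {lo hi : ℕ} →
                 IsIndicator f lo hi → IsIndicator (f ∘ suc) (pred lo) (pred hi)
indicator-tail {lo = lo} ind j =
  Reflects-map (λ (p , q) → pred-mono-≤ p , <⇒≤pred q) (λ (p , q) → pred≤⇒≤suc lo p , pred-cancel-< q)
               (ind (suc j))

indicator-count : {f : Fin n → Bool} {lo hi : ℕ} → IsIndicator f lo hi → hi ≤ n → count f ≡ hi ∸ lo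
indicator-count {zero}  {lo = lo} _   z≤n = sym (0∸n≡0 lo)
indicator-count {suc n} {f} {lo} {hi} ind hi≤ = begin
  bit (f zero) + count (f ∘ suc)      ≡⟨ cong (bit (f zero) +_) (indicator-count (indicator-tail ind) (pred-mono-≤ hi≤)) ⟩
  bit (f zero) + (pred hi ∸ pred lo)  ≡⟨ first-cell lo hi (ind zero) ⟩
  hi ∸ lo                             ∎
  where
  open ≡-Reasoning
  first-cell : ∀ lo hi {b} → Reflects (lo ≤ 0 × 0 < hi) b → bit b + (pred hi ∸ pred lo) ≡ hi ∸ lo
  first-cell zero    zero    (ofⁿ _)  = refl
  first-cell zero    (suc h) (ofʸ _)  = refl
  first-cell zero    (suc h) (ofⁿ ¬p) = contradiction (z≤n , z<s) ¬p
  first-cell (suc l) zero    (ofⁿ _)  = 0∸n≡0 l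
  first-cell (suc l) (suc h) (ofⁿ _)  = refl

indicator-true : {f : Fin n → Bool} {lo hi k : ℕ} → IsIndicator f lo hi →
                 (k<n : k < n) → lo ≤ k → k < hi → f (fromℕ< k<n) ≡ true
indicator-true {lo = lo} {hi} ind k<n lo≤k k<hi =
  reflects-⇒true (ind _) (subst (λ x → lo ≤ x × x < hi) (sym (toℕ-fromℕ< k<n)) (lo≤k , k<hi))

indicator-leftmost : {P : Tableau m n} {i : Fin m} {lo hi : ℕ} {a : Fin n} →
                     IsIndicator (P i) lo hi → IsLeftmost P i a → toℕ a ≡ lo
indicator-leftmost {lo = lo} {hi} {a} ind (Pia , before) = ≤-antisym (≮⇒≥ no-earlier-one) lo≤a
  where
  lo≤a : lo ≤ toℕ a
  lo≤a = proj₁ (reflects-true⇒ (ind a) Pia)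
  no-earlier-one : ¬ lo < toℕ a
  no-earlier-one lo<a =
    not-¬ (indicator-true ind lo<n ≤-refl (<-trans lo<a (proj₂ (reflects-true⇒ (ind a) Pia))))
          (before _ (subst (_< toℕ a) (sym (toℕ-fromℕ< lo<n)) lo<a))
    where
    lo<n = <-trans lo<a (toℕ<n a)

indicator-rightmost : {P : Tableau m n} {i : Fin m} {lo hi : ℕ} {b : Fin n} →
                      IsIndicator (P i) lo hi → hi ≤ n → IsRightmost P i b → toℕ b ≡ pred hi
indicator-rightmost {lo = lo} {hi} {b} ind hi≤n (Pib , after) = ≤-antisym (<⇒≤pred b<hi) (≮⇒≥ no-later-one)
  where
  b<hi : toℕ b < hi
  b<hi = proj₂ (reflects-true⇒ (ind b) Pib)
  pred-hi<hi : pred hi < hi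
  pred-hi<hi = pred<-of-≤ ≤-refl (≤-<-trans z≤n b<hi)
  no-later-one : ¬ toℕ b < pred hi
  no-later-one b<pred-hi =
    not-¬ (indicator-true ind last<n (≤-trans (proj₁ (reflects-true⇒ (ind b) Pib)) (<⇒≤ b<pred-hi)) pred-hi<hi)
          (after _ (subst (toℕ b <_) (sym (toℕ-fromℕ< last<n)) b<pred-hi))
    where
    last<n = <-≤-trans pred-hi<hi hi≤n

-- Rows of the form 0 ⋯ 0 1 ⋯ 1

ZerosLeft : (Fin n → Bool) → Set
ZerosLeft f = ∀ j j' → j' Fin.< j → f j ≡ false → f j' ≡ false

firstOne : (Fin n → Bool) → ℕ
firstOne {zero}  f = 0
firstOne {suc n} f = if f zero then 0 else suc (firstOne (f ∘ suc))

firstOne-≤ : (f : Fin n → Bool) → firstOne f ≤ n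
firstOne-≤ {zero}  f = z≤n
firstOne-≤ {suc n} f with f zero
... | true  = z≤n
... | false = s≤s (firstOne-≤ (f ∘ suc))

firstOne-reflects : {f : Fin n → Bool} → ZerosLeft f → ∀ j → Reflects (firstOne f ≤ toℕ j) (f j)
firstOne-reflects {suc n} {f} zl zero with f zero
... | true  = ofʸ z≤n
... | false = ofⁿ λ ()
firstOne-reflects {suc n} {f} zl (suc j) with f zero in f0
... | true  = subst (Reflects _) (sym (¬-not λ fj → not-¬ f0 (zl (suc j) zero z<s fj))) (ofʸ z≤n)
... | false = Reflects-map s≤s s≤s⁻¹ (firstOne-reflects (λ k k' k'<k → zl (suc k) (suc k') (s<s k'<k)) j)

firstOne-mono : {f g : Fin n → Bool} → ZerosLeft f → ZerosLeft g → g ⊆ f → firstOne f ≤ firstOne g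
firstOne-mono {n} {f} {g} zlf zlg g⊆f with firstOne g <? n
... | no  g≮n = ≤-trans (firstOne-≤ f) (≮⇒≥ g≮n)
... | yes g<n = subst (firstOne f ≤_) (toℕ-fromℕ< g<n)
                  (reflects-true⇒ (firstOne-reflects zlf j)
                    (g⊆f j (reflects-⇒true (firstOne-reflects zlg j) (≤-reflexive (sym (toℕ-fromℕ< g<n))))))
  where
  j = fromℕ< g<n

-- Sorting

injective⇒hits : {f : Fin n → Fin n} → Injective _≡_ _≡_ f → ∀ y → ¬ (∀ x → f x ≢ y)
injective⇒hits {suc n} {f} f-inj y miss = 1+n≰n (injective⇒≤ {f = squeeze} squeeze-injective)
  where
  squeeze : Fin (suc n) → Fin n
  squeeze x = punchOut (miss x ∘ sym)
  squeeze-injective : Injective _≡_ _≡_ squeeze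
  squeeze-injective e = f-inj (punchOut-injective (miss _ ∘ sym) (miss _ ∘ sym) e)

injective⇒strictlySurjective : {f : Fin n → Fin n} → Injective _≡_ _≡_ f → StrictlySurjective _≡_ f
injective⇒strictlySurjective {f = f} f-inj y with any? (λ x → f x Finₚ.≟ y)
... | yes hit  = hit
... | no  miss = contradiction (λ x fx≡y → miss (x , fx≡y)) (injective⇒hits f-inj y)

module Ranking {_≺_ : Fin N → Fin N → Set}
  (≺-irrefl : ∀ {a} → ¬ a ≺ a) (≺-trans : Transitive _≺_)
  (≺-connex : ∀ a b → a ≺ b ⊎ a ≡ b ⊎ b ≺ a) where

  _≺?_ : ∀ a b → Dec (a ≺ b)
  a ≺? b with ≺-connex a b
  ... | inj₁ a≺b        = yes a≺b
  ... | inj₂ (inj₁ refl) = no ≺-irrefl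
  ... | inj₂ (inj₂ b≺a) = no λ a≺b → ≺-irrefl (≺-trans a≺b b≺a)

  before : Fin N → Fin N → Bool
  before b a = does (a ≺? b)

  rank : Fin N → Fin N
  rank b = fromℕ< (count-< {f = before b} b (reflects-⇒false (proof (b ≺? b)) ≺-irrefl))

  rank-mono : ∀ {a b} → a ≺ b → rank a Fin.< rank b
  rank-mono {a} {b} a≺b =
    subst₂ _<_ (sym (toℕ-fromℕ< _)) (sym (toℕ-fromℕ< _))
      (count-strict before-a⊆before-b a (reflects-⇒false (proof (a ≺? a)) ≺-irrefl)
                                        (reflects-⇒true (proof (a ≺? b)) a≺b))
    where
    before-a⊆before-b : before a ⊆ before b
    before-a⊆before-b x x≺a =
      reflects-⇒true (proof (x ≺? b)) (≺-trans (reflects-true⇒ (proof (x ≺? a)) x≺a) a≺b)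

  rank-injective : Injective _≡_ _≡_ rank
  rank-injective {a} {b} e with ≺-connex a b
  ... | inj₁ a≺b        = contradiction e (Finₚ.<⇒≢ (rank-mono a≺b))
  ... | inj₂ (inj₁ a≡b) = a≡b
  ... | inj₂ (inj₂ b≺a) = contradiction (sym e) (Finₚ.<⇒≢ (rank-mono b≺a))

  unrank : Fin N → Fin N
  unrank j = proj₁ (injective⇒strictlySurjective rank-injective j)

  rank-unrank : ∀ j → rank (unrank j) ≡ j
  rank-unrank j = proj₂ (injective⇒strictlySurjective rank-injective j)

  unrank-bijective : Bijective _≡_ _≡_ unrank
  unrank-bijective =
    (λ {j} {j'} e → trans (sym (rank-unrank j)) (trans (cong rank e) (rank-unrank j'))) ,
    strictlySurjective⇒surjective (λ a → rank a , rank-injective (rank-unrank (rank a)))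

  unrank-mono : ∀ {j j'} → j' Fin.< j → unrank j' ≺ unrank j
  unrank-mono {j} {j'} j'<j with ≺-connex (unrank j') (unrank j)
  ... | inj₁ r        = r
  ... | inj₂ (inj₁ e) =
    contradiction (trans (sym (rank-unrank j')) (trans (cong rank e) (rank-unrank j))) (Finₚ.<⇒≢ j'<j)
  ... | inj₂ (inj₂ r) =
    contradiction j'<j (Finₚ.<-asym (subst₂ Fin._<_ (rank-unrank j) (rank-unrank j') (rank-mono r)))

-- The constructive form of "the rows of F are totally ordered by inclusion".
IsChain : (Fin N → Fin M → Bool) → Set
IsChain F = ∀ a b x → F a x ≡ false → F b x ≡ true → F a ⊆ F b

zerosLeft⇒chain : {F : Fin N → Fin M → Bool} → (∀ a → ZerosLeft (F a)) → IsChain F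
zerosLeft⇒chain {F = F} zl a b x Fax Fbx y Fay with Finₚ.<-cmp y x
... | tri< y<x _ _ = contradiction (zl a x y y<x Fax) (not-¬ Fay)
... | tri≈ _ refl _ = contradiction Fax (not-¬ Fay)
... | tri> _ _ x<y with F b y in Fby
...   | true  = refl
...   | false = contradiction (zl b y x x<y Fby) (not-¬ Fbx)

record IsDecreasingSort (F : Fin N → Fin M → Bool) (π : Fin N → Fin N) : Set where
  field
    bijective  : Bijective _≡_ _≡_ π
    decreasing : ∀ {j j'} → j' Fin.< j → F (π j) ⊆ F (π j')
    stable     : ∀ {j j'} → j' Fin.< j → F (π j) ≗ F (π j') → π j' Fin.< π j

decreasingSort : (F : Fin N → Fin M → Bool) → IsChain F → Σ (Fin N → Fin N) (IsDecreasingSort F)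
decreasingSort {N} F chain = unrank , record
  { bijective  = unrank-bijective
  ; decreasing = decreasing
  ; stable     = stable
  }
  where
  size : Fin N → ℕ
  size a = count (F a)

  _≺_ : Fin N → Fin N → Set
  a ≺ b = size b < size a ⊎ (size a ≡ size b × a Fin.< b)

  ≺-irrefl : ∀ {a} → ¬ a ≺ a
  ≺-irrefl (inj₁ p)       = <-irrefl refl p
  ≺-irrefl (inj₂ (_ , p)) = <-irrefl refl p

  ≺-trans : Transitive _≺_
  ≺-trans (inj₁ p)       (inj₁ q)        = inj₁ (<-trans q p)
  ≺-trans (inj₁ p)       (inj₂ (e , _))  = inj₁ (subst (_< _) e p)
  ≺-trans (inj₂ (e , _)) (inj₁ q)        = inj₁ (subst (_ <_) (sym e) q)
  ≺-trans (inj₂ (e , p)) (inj₂ (e' , q)) = inj₂ (trans e e' , <-trans p q)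

  ≺-connex : ∀ a b → a ≺ b ⊎ a ≡ b ⊎ b ≺ a
  ≺-connex a b with <-cmp (size a) (size b)
  ... | tri< p _ _ = inj₂ (inj₂ (inj₁ p))
  ... | tri> _ _ p = inj₁ (inj₁ p)
  ... | tri≈ _ e _ with Finₚ.<-cmp a b
  ...   | tri< p _ _   = inj₁ (inj₂ (e , p))
  ...   | tri≈ _ a≡b _ = inj₂ (inj₁ a≡b)
  ...   | tri> _ _ p   = inj₂ (inj₂ (inj₂ (sym e , p)))

  ≺⇒size≥ : ∀ {a b} → a ≺ b → size b ≤ size a
  ≺⇒size≥ (inj₁ p)       = <⇒≤ p
  ≺⇒size≥ (inj₂ (e , _)) = ≤-reflexive (sym e)

  open Ranking ≺-irrefl ≺-trans ≺-connex

  decreasing : ∀ {j j'} → j' Fin.< j → F (unrank j) ⊆ F (unrank j')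
  decreasing {j} {j'} j'<j x Fx with F (unrank j') x in F'x
  ... | true  = refl
  ... | false = contradiction (≺⇒size≥ (unrank-mono j'<j)) (<⇒≱ (count-strict (chain _ _ x F'x Fx) x F'x Fx))

  stable : ∀ {j j'} → j' Fin.< j → F (unrank j) ≗ F (unrank j') → unrank j' Fin.< unrank j
  stable j'<j same with unrank-mono j'<j
  ... | inj₁ smaller       = contradiction (count-cong same) (<⇒≢ smaller)
  ... | inj₂ (_ , earlier) = earlier

phiPermutations : {T : Tableau m n} → IsEW T →
                  Σ (Fin n → Fin n) (λ σ → Σ (Fin m → Fin m) (λ τ → IsPhiPerm T σ τ))
phiPermutations {m} {n} {T} ew = σ , τ , columnStep , rowStep
  where
  open IsEW ew

  zeroSets : Fin n → Fin m → Bool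
  zeroSets k i = not (T i k)

  zeroSets-chain : IsChain zeroSets
  zeroSets-chain a b x Tax Tbx y Tay with T y b in Tyb
  ... | false = refl
  ... | true  = contradiction
      (x , y , b , a , (λ { refl → not-¬ Tax Tay }) , (λ { refl → not-¬ Tax Tbx }) ,
       not-injective {y = false} Tbx , not-injective {y = false} Tay , not-injective {y = true} Tax , Tyb)
      noPattern

  σ-sort : Σ (Fin n → Fin n) (IsDecreasingSort zeroSets)
  σ-sort = decreasingSort zeroSets zeroSets-chain

  σ : Fin n → Fin n
  σ = proj₁ σ-sort

  module σ = IsDecreasingSort (proj₂ σ-sort)

  columnStep : IsColumnStep T σ
  columnStep = record
    { colBij    = σ.bijective
    ; zerosLeft = λ i j j' j'<j Tij≡0 → not-injective {y = false} (σ.decreasing j'<j i (cong not Tij≡0))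
    ; colTies   = λ j j' j'<j same → σ.stable j'<j (cong not ∘ same)
    }

  τ-sort : Σ (Fin m → Fin m) (IsDecreasingSort (colPermuted T σ))
  τ-sort = decreasingSort (colPermuted T σ) (zerosLeft⇒chain (IsColumnStep.zerosLeft columnStep))

  τ : Fin m → Fin m
  τ = proj₁ τ-sort

  module τ = IsDecreasingSort (proj₂ τ-sort)

  rowStep : IsRowStep (colPermuted T σ) τ
  rowStep = record
    { rowBij    = τ.bijective
    ; onesAbove = λ i i' j i'<i → τ.decreasing i'<i j
    ; rowTies   = λ i i' i'<i → τ.stable i'<i
    }

-- The ribbon of a staircase

data NextFin {n : ℕ} (i : Fin n) : Maybe (Fin n) → Set where
  last : suc (toℕ i) ≡ n → NextFin i nothing
  next : ∀ {i₁} → toℕ i₁ ≡ suc (toℕ i) → NextFin i (just i₁)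

nextFin-view : (i : Fin n) → NextFin i (nextFin i)
nextFin-view {suc zero}    zero    = last refl
nextFin-view {suc zero}    (suc ())
nextFin-view {suc (suc n)} zero    = next refl
nextFin-view {suc (suc n)} (suc i) with nextFin i | nextFin-view i
... | nothing | last e = last (cong suc e)
... | just _  | next e = next (cong suc e)

-- For a row of S whose 1s start at column c, followed by a row whose 1s start at column h, step (3)
-- keeps a 1 of S lying above a 0 and a 0 of S lying left of a 1: together the columns pred c ≤ j < h.
ribbonCell⇒interval : ∀ {c h j} → c ≤ h → (c ≤ j × j < h) ⊎ (¬ c ≤ j × c ≤ suc j) → pred c ≤ j × j < h
ribbonCell⇒interval _   (inj₁ (c≤j , j<h))   = ≤-trans pred[n]≤n c≤j , j<h
ribbonCell⇒interval c≤h (inj₂ (c≰j , c≤1+j)) = pred-mono-≤ c≤1+j , <-≤-trans (≰⇒> c≰j) c≤h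

interval⇒ribbonCell : ∀ {c h j} → pred c ≤ j × j < h → (c ≤ j × j < h) ⊎ (¬ c ≤ j × c ≤ suc j)
interval⇒ribbonCell {c} {j = j} (pred-c≤j , j<h) with c ≤? j
... | yes c≤j = inj₁ (c≤j , j<h)
... | no  c≰j = inj₂ (c≰j , pred≤⇒≤suc c pred-c≤j)

-- E 0 is moved to the left so that the right-hand side needs no subtraction.
sum-telescope : (E : ℕ → ℕ) → (∀ k → E k ≤ E (suc k)) → ∀ m →
                sum (tabulate {n = m} (λ i → suc (E (suc (toℕ i))) ∸ E (toℕ i))) + E 0 ≡ m + E m
sum-telescope E step zero    = refl
sum-telescope E step (suc m) = begin
  (d + rest) + E 0  ≡⟨ cong (_+ E 0) (+-comm d rest) ⟩
  (rest + d) + E 0  ≡⟨ +-assoc rest d (E 0) ⟩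
  rest + (d + E 0)  ≡⟨ cong (rest +_) (m∸n+n≡m (m≤n⇒m≤1+n (step 0))) ⟩
  rest + suc (E 1)  ≡⟨ +-suc rest (E 1) ⟩
  suc (rest + E 1)  ≡⟨ cong suc (sum-telescope (E ∘ suc) (step ∘ suc) m) ⟩
  suc (m + E (suc m)) ∎
  where
  open ≡-Reasoning
  d    = suc (E 1) ∸ E 0
  rest = sum (tabulate {n = m} (λ i → suc (E (suc (suc (toℕ i)))) ∸ E (suc (toℕ i))))

module Staircase {m n : ℕ} (S : Tableau (suc m) (suc n))
  (rows-zerosLeft    : ∀ i → ZerosLeft (S i))
  (rows-nested       : ∀ {i i'} → i Fin.< i' → S i' ⊆ S i)
  (topRow-ones       : ∀ j → S zero j ≡ true)
  (firstColumn-zeros : ∀ i → S (suc i) zero ≡ false)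
  where

  R : Tableau (suc m) (suc n)
  R = ribbonOf S

  -- rowStart k is the column of the first 1 in row k of S, and suc n below the last row
  rowStart : ℕ → ℕ
  rowStart k with k <? suc m
  ... | yes k<m = firstOne (S (fromℕ< k<m))
  ... | no  _   = suc n

  rowStart-fromℕ< : ∀ {k} (k<m : k < suc m) → rowStart k ≡ firstOne (S (fromℕ< k<m))
  rowStart-fromℕ< {k} k<m with k <? suc m
  ... | yes _   = refl
  ... | no  k≮m = contradiction k<m k≮m

  rowStart-beyond : ∀ {k} → suc m ≤ k → rowStart k ≡ suc n
  rowStart-beyond {k} m≤k with k <? suc m
  ... | yes k<m = contradiction m≤k (<⇒≱ k<m)
  ... | no  _   = refl

  rowStart-≤ : ∀ k → rowStart k ≤ suc n
  rowStart-≤ k with k <? suc m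
  ... | yes k<m = firstOne-≤ (S (fromℕ< k<m))
  ... | no  _   = ≤-refl

  row-reflects : ∀ i j → Reflects (rowStart (toℕ i) ≤ toℕ j) (S i j)
  row-reflects i j rewrite rowStart-fromℕ< (toℕ<n i) | fromℕ<-toℕ i (toℕ<n i) =
    firstOne-reflects (rows-zerosLeft i) j

  rowStart-mono : ∀ {k k'} → k ≤ k' → rowStart k ≤ rowStart k'
  rowStart-mono {k} {k'} k≤k' with m≤n⇒m<n∨m≡n k≤k'
  ... | inj₂ refl = ≤-refl
  ... | inj₁ k<k' with <-≤-connex k' (suc m)
  ...   | inj₂ m≤k' = subst (rowStart k ≤_) (sym (rowStart-beyond m≤k')) (rowStart-≤ k)
  ...   | inj₁ k'<m = begin
    rowStart k                  ≡⟨ rowStart-fromℕ< k<m ⟩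
    firstOne (S (fromℕ< k<m))   ≤⟨ firstOne-mono (rows-zerosLeft _) (rows-zerosLeft _) (rows-nested row<row') ⟩
    firstOne (S (fromℕ< k'<m))  ≡⟨ sym (rowStart-fromℕ< k'<m) ⟩
    rowStart k'                 ∎
    where
    open ≤-Reasoning
    k<m = <-trans k<k' k'<m
    row<row' = subst₂ _<_ (sym (toℕ-fromℕ< k<m)) (sym (toℕ-fromℕ< k'<m)) k<k'

  rowStart-zero : rowStart 0 ≡ 0
  rowStart-zero = n≤0⇒n≡0 (reflects-true⇒ (row-reflects zero zero) (topRow-ones zero))

  rowStart-pos : ∀ k → 0 < rowStart (suc k)
  rowStart-pos k with <-≤-connex (suc k) (suc m)
  ... | inj₁ k+1<m = subst (0 <_) (sym (rowStart-fromℕ< k+1<m))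
                       (≰⇒> (reflects-false⇒ (firstOne-reflects (rows-zerosLeft _) zero) (firstColumn-zeros _)))
  ... | inj₂ m≤k+1 = subst (0 <_) (sym (rowStart-beyond m≤k+1)) z<s

  suc-pred-rowStart : ∀ k → suc (pred (rowStart (suc k))) ≡ rowStart (suc k)
  suc-pred-rowStart k = suc-pred (rowStart (suc k)) {{>-nonZero (rowStart-pos k)}}

  below-reflects : ∀ i j → Reflects (toℕ j < rowStart (suc (toℕ i))) (maybe (λ i₁ → not (S i₁ j)) true (nextFin i))
  below-reflects i j with nextFin i | nextFin-view i
  ... | nothing | last i-last =
    ofʸ (subst (toℕ j <_) (sym (rowStart-beyond (≤-reflexive (sym i-last)))) (toℕ<n j))
  ... | just i₁ | next i₁-next =
    Reflects-map ≰⇒> <⇒≱ (¬-reflects (subst (λ k → Reflects (rowStart k ≤ toℕ j) (S i₁ j)) i₁-next (row-reflects i₁ j)))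

  right-reflects : ∀ i j → Reflects (rowStart (toℕ i) ≤ suc (toℕ j)) (maybe (λ j₁ → S i j₁) true (nextFin j))
  right-reflects i j with nextFin j | nextFin-view j
  ... | nothing | last j-last  = ofʸ (subst (rowStart (toℕ i) ≤_) (sym j-last) (rowStart-≤ (toℕ i)))
  ... | just j₁ | next j₁-next = subst (λ k → Reflects (rowStart (toℕ i) ≤ k) (S i j₁)) j₁-next (row-reflects i j₁)

  R-row : ∀ i → IsIndicator (R i) (pred (rowStart (toℕ i))) (rowStart (suc (toℕ i)))
  R-row i j = Reflects-map (ribbonCell⇒interval (rowStart-mono (n≤1+n _))) interval⇒ribbonCell
    ((row-reflects i j ×-reflects below-reflects i j) ⊎-reflects (¬-reflects (row-reflects i j) ×-reflects right-reflects i j))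

  R-leftmost : ∀ {i a} → IsLeftmost R i a → toℕ a ≡ pred (rowStart (toℕ i))
  R-leftmost {i} = indicator-leftmost {P = R} {i} (R-row i)

  R-rightmost : ∀ {i b} → IsRightmost R i b → toℕ b ≡ pred (rowStart (suc (toℕ i)))
  R-rightmost {i} = indicator-rightmost {P = R} {i} (R-row i) (rowStart-≤ (suc (toℕ i)))

  R-row-nonempty : ∀ (i : Fin (suc m)) → pred (rowStart (toℕ i)) < rowStart (suc (toℕ i))
  R-row-nonempty i = pred<-of-≤ (rowStart-mono (n≤1+n (toℕ i))) (rowStart-pos (toℕ i))

  consecutive : ∀ i i' → toℕ i' ≡ suc (toℕ i) → ∀ a b a' b' →
                IsLeftmost R i a → IsRightmost R i b → IsLeftmost R i' a' → IsRightmost R i' b' →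
                (a Fin.≤ a' × a' Fin.≤ b) × b Fin.≤ b'
  consecutive i i' i'-next a b a' b' la ra la' ra' =
    ( subst₂ _≤_ (sym (R-leftmost la)) (sym (R-leftmost la')) (pred-mono-≤ (rowStart-mono i≤i'))
    , subst₂ _≤_ (sym (R-leftmost la')) (sym (R-rightmost ra)) (≤-reflexive (cong (pred ∘ rowStart) i'-next)) )
    , subst₂ _≤_ (sym (R-rightmost ra)) (sym (R-rightmost ra')) (pred-mono-≤ (rowStart-mono (s≤s i≤i')))
    where
    i≤i' : toℕ i ≤ toℕ i'
    i≤i' = subst (toℕ i ≤_) (sym i'-next) (n≤1+n _)

  R-count : ∀ i → countTrue (R i) ≡ suc (pred (rowStart (suc (toℕ i)))) ∸ pred (rowStart (toℕ i))
  R-count i = begin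
    countTrue (R i)                                   ≡⟨ countTrue≡count (R i) ⟩
    count (R i)                                       ≡⟨ indicator-count (R-row i) (rowStart-≤ (suc (toℕ i))) ⟩
    rowStart (suc (toℕ i)) ∸ pred (rowStart (toℕ i))  ≡⟨ cong (_∸ pred (rowStart (toℕ i))) (sym (suc-pred-rowStart (toℕ i))) ⟩
    suc (pred (rowStart (suc (toℕ i)))) ∸ pred (rowStart (toℕ i)) ∎
    where open ≡-Reasoning

  R-numOnes : numOnes R ≡ suc m + suc n ∸ 1
  R-numOnes = begin
    sum (map (countTrue ∘ R) (allFin (suc m)))                     ≡⟨ cong sum (map-tabulate id (countTrue ∘ R)) ⟩
    sum (tabulate (countTrue ∘ R))                                  ≡⟨ cong sum (tabulate-cong R-count) ⟩
    total                                                           ≡⟨ sym (+-identityʳ total) ⟩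
    total + 0                                                       ≡⟨ cong (λ s → total + pred s) (sym rowStart-zero) ⟩
    total + pred (rowStart 0)                                       ≡⟨ sum-telescope (pred ∘ rowStart) step (suc m) ⟩
    suc m + pred (rowStart (suc m))                                 ≡⟨ cong (λ s → suc m + pred s) (rowStart-beyond ≤-refl) ⟩
    suc m + n                                                       ≡⟨ cong (_∸ 1) (+-suc (suc m) n) ⟨
    suc m + suc n ∸ 1                                               ∎
    where
    open ≡-Reasoning
    total = sum (tabulate {n = suc m} (λ i → suc (pred (rowStart (suc (toℕ i)))) ∸ pred (rowStart (toℕ i))))
    step : ∀ k → pred (rowStart k) ≤ pred (rowStart (suc k))
    step k = pred-mono-≤ (rowStart-mono (n≤1+n k))

  ribbon : IsRibbonPolyomino R
  ribbon = record
    { isPP = record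
      { firstCorner   = λ
        { zero zero _ _ → reflects-⇒true (R-row zero zero)
                            (subst (λ s → pred s ≤ 0) (sym rowStart-zero) z≤n , rowStart-pos 0)
        ; zero (suc _) _ () ; (suc _) _ () _ }
      ; lastCorner    = λ i j i-last j-last → reflects-⇒true (R-row i j)
          ( subst (pred (rowStart (toℕ i)) ≤_) (suc-injective (sym j-last)) (pred-mono-≤ (rowStart-≤ (toℕ i)))
          , subst (toℕ j <_) (sym (rowStart-beyond (≤-reflexive (sym i-last)))) (toℕ<n j) )
      ; rowNonempty   = λ i → _ , indicator-true {f = R i} (R-row i) (<-≤-trans (R-row-nonempty i) (rowStart-≤ (suc (toℕ i)))) ≤-refl (R-row-nonempty i)
      ; rowContiguous = λ i j k l j≤k k≤l Rij Ril → reflects-⇒true (R-row i k)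
          ( ≤-trans (proj₁ (reflects-true⇒ (R-row i j) Rij)) j≤k
          , ≤-<-trans k≤l (proj₂ (reflects-true⇒ (R-row i l) Ril)) )
      ; consecutive   = consecutive
      }
    ; minimal = R-numOnes
    }

  sameLeftmost⇒sameRow : ∀ {i i' a} → IsLeftmost R (suc i) a → IsLeftmost R (suc i') a → S (suc i) ≗ S (suc i')
  sameLeftmost⇒sameRow {i} {i'} la la' j =
    det (row-reflects (suc i) j) (subst (λ s → Reflects (s ≤ toℕ j) (S (suc i') j)) (sym same-start) (row-reflects (suc i') j))
    where
    open ≡-Reasoning
    same-start : rowStart (suc (toℕ i)) ≡ rowStart (suc (toℕ i'))
    same-start = begin
      rowStart (suc (toℕ i))                ≡⟨ suc-pred-rowStart (toℕ i) ⟨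
      suc (pred (rowStart (suc (toℕ i))))   ≡⟨ cong suc (trans (sym (R-leftmost la)) (R-leftmost la')) ⟩
      suc (pred (rowStart (suc (toℕ i'))))  ≡⟨ suc-pred-rowStart (toℕ i') ⟩
      rowStart (suc (toℕ i'))               ∎

  topmost-rowStart : ∀ {j a} → IsTopmost R j a → rowStart (toℕ a) ≤ toℕ j
  topmost-rowStart {j} {zero}  _ = subst (_≤ toℕ j) (sym rowStart-zero) z≤n
  topmost-rowStart {j} {suc a} (Raj , above) with rowStart (suc (toℕ a)) ≤? toℕ j
  ... | yes ok     = ok
  ... | no  start≰j = contradiction (above (inject₁ a) row-above<a) (not-¬ R-above)
    where
    row-above<a : toℕ (inject₁ a) < suc (toℕ a)
    row-above<a = s≤s (≤-reflexive (toℕ-inject₁ a))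
    R-above : R (inject₁ a) j ≡ true
    R-above = reflects-⇒true (R-row (inject₁ a) j)
      (subst (λ k → pred (rowStart k) ≤ toℕ j × toℕ j < rowStart (suc k)) (sym (toℕ-inject₁ a))
        ( ≤-trans (pred-mono-≤ (rowStart-mono (n≤1+n (toℕ a)))) (proj₁ (reflects-true⇒ (R-row (suc a) j) Raj))
        , ≰⇒> start≰j ))

  sameTopmost⇒sameColumn : ∀ {j j' a} → j Fin.< j' → IsTopmost R j a → IsTopmost R j' a → ∀ i → S i j ≡ S i j'
  sameTopmost⇒sameColumn {j} {j'} {a} j<j' ta ta' i =
    det (row-reflects i j) (Reflects-map shrink (λ p → ≤-trans p (<⇒≤ j<j')) (row-reflects i j'))
    where
    j'<next : toℕ j' < rowStart (suc (toℕ a))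
    j'<next = proj₂ (reflects-true⇒ (R-row a j') (proj₁ ta'))
    shrink : rowStart (toℕ i) ≤ toℕ j' → rowStart (toℕ i) ≤ toℕ j
    shrink start≤j' = ≤-trans (rowStart-mono i≤a) (topmost-rowStart ta)
      where
      i≤a : toℕ i ≤ toℕ a
      i≤a = ≮⇒≥ λ a<i → <⇒≱ (≤-<-trans start≤j' j'<next) (rowStart-mono a<i)

module PhiPermutation {m n : ℕ} {T : Tableau (suc m) (suc n)} (ew : IsEW T)
  {σ : Fin (suc n) → Fin (suc n)} {τ : Fin (suc m) → Fin (suc m)}
  (columnStep : IsColumnStep T σ) (rowStep : IsRowStep (colPermuted T σ) τ) where

  open IsEW ew
  open IsColumnStep columnStep
  open IsRowStep rowStep

  S : Tableau (suc m) (suc n)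
  S = permuted T σ τ

  σ-onto : StrictlySurjective _≡_ σ
  σ-onto = surjective⇒strictlySurjective (proj₂ colBij)

  τ-onto : StrictlySurjective _≡_ τ
  τ-onto = surjective⇒strictlySurjective (proj₂ rowBij)

  topRow-ones : ∀ j → S zero j ≡ true
  topRow-ones j with τ-onto zero
  ... | zero  , τ0≡0 = subst (λ r → T r (σ j) ≡ true) (sym τ0≡0) (topRowOnes zero (σ j) refl)
  ... | suc r , τr≡0 = onesAbove (suc r) zero j z<s (subst (λ r → T r (σ j) ≡ true) (sym τr≡0) (topRowOnes zero (σ j) refl))

  τ-zero : τ zero ≡ zero
  τ-zero with τ zero in τ0
  ... | zero  = refl
  ... | suc r with otherRowsZero (suc r) (λ ())
  ...   | k , T[r+1,k]≡0 with σ-onto k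
  ...     | j , refl = contradiction (subst (λ r' → T r' (σ j) ≡ false) (sym τ0) T[r+1,k]≡0) (not-¬ (topRow-ones j))

  τ-suc≢zero : ∀ i → τ (suc i) ≢ zero
  τ-suc≢zero i e with proj₁ rowBij (trans e (sym τ-zero))
  ... | ()

  firstColumn-zeros : ∀ i → S (suc i) zero ≡ false
  firstColumn-zeros i with otherRowsZero (τ (suc i)) (τ-suc≢zero i ∘ toℕ-injective)
  ... | k , T≡0 with σ-onto k
  ...   | zero  , refl = T≡0
  ...   | suc j , refl = zerosLeft (τ (suc i)) (suc j) zero z<s T≡0

  open Staircase S (λ i → zerosLeft (τ i)) (λ {i} {i'} i<i' j → onesAbove i' i j i<i') topRow-ones firstColumn-zeros

  rowLabels-increasing : ∀ i i' a → i Fin.< i' → IsLeftmost R i a → IsLeftmost R i' a → τ i Fin.< τ i'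
  rowLabels-increasing zero    (suc i') _ _   _  _   =
    subst (Fin._< τ (suc i')) (sym τ-zero) (Finₚ.≤∧≢⇒< z≤n (τ-suc≢zero i' ∘ sym))
  rowLabels-increasing (suc i) (suc i') _ i<i' la la' = rowTies (suc i') (suc i) i<i' (sym ∘ sameLeftmost⇒sameRow la la')

  colLabels-increasing : ∀ j j' a → j Fin.< j' → IsTopmost R j a → IsTopmost R j' a → σ j Fin.< σ j'
  colLabels-increasing j j' a j<j' ta ta' = colTies j' j j<j' same-column
    where
    same-column : ∀ r → T r (σ j') ≡ T r (σ j)
    same-column r with τ-onto r
    ... | i , refl = sym (sameTopmost⇒sameColumn j<j' ta ta' i)

  isLRib : IsLRib (phiShape T σ τ) (phiLabel σ τ)
  isLRib = record
    { ribbon        = ribbon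
    ; rowPerm       = rowBij
    ; colPerm       = colBij
    ; firstRowLabel = λ { zero _ → cong toℕ τ-zero }
    ; rowLabelsIncr = rowLabels-increasing
    ; colLabelsIncr = colLabels-increasing
    }

proposition3p2 : (m n : ℕ) → 1 ≤ m → 1 ≤ n → (T : Tableau m n) → IsEW T →
    Σ (Fin n → Fin n) (λ σ → Σ (Fin m → Fin m) (λ τ → IsPhiPerm T σ τ))
    × ((σ : Fin n → Fin n) → (τ : Fin m → Fin m) → IsPhiPerm T σ τ →
       IsLRib (phiShape T σ τ) (phiLabel σ τ))
proposition3p2 (suc m) (suc n) _ _ T ew =
  phiPermutations ew , λ σ τ (columnStep , rowStep) → PhiPermutation.isLRib ew columnStep rowStep
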